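{- Let $\langle S,\to\rangle$ be a parallel transaction system over a finite thread set $T$ (as in the context). For every uts $q_1\to_{\psi(1)}^{+}q_2\to_{\psi(2)}^{+}\cdots\to_{\psi(l)}^{+}q_{l+1}$ (under any $T'\subseteq T$) and all $i,j\in\{1,\dots,l\}$ with $i\ne j$, we have $\psi(i)\neq\psi(j)$.
   Context: Notation: for $X\subseteq S$, $Q\subseteq S\times S$: $X\lhd Q=Q\cap(X\times S)$, $Q\rhd X=Q\cap(S\times X)$; for $X\subseteq T$, $\mathcal N_X=\bigcap_{i\in X}\mathcal N_i$. A transition system over $T$ is $\langle S,\to\rangle$ with $\to=\bigcup_{i\in T}\to_i$. A thread bisimulation is an equivalence $R$ on $S$ such that $(\sigma,\sigma')\in R$ and $\sigma\to_i\sigma_1$ imply $\sigma'\to_i\sigma_1'$ for some $\sigma_1'$ with $(\sigma_1,\sigma_1')\in R$. For $A,B\subseteq S\times S$ and equivalence $R$: $A$ right-commutes with $B$ up to $R$ iff whenever $(\sigma_1,\sigma_2)\in A,(\sigma_2,\sigma_3)\in B$ there are $\sigma_4,\sigma_3'$ with $(\sigma_1,\sigma_4)\in B,(\sigma_4,\sigma_3')\in A,(\sigma_3,\sigma_3')\in R$; $A$ left-commutes with $B$ up to $R$ iff whenever $(\sigma_1,\sigma_2)\in B,(\sigma_2,\sigma_3)\in A$ there are $\sigma_4,\sigma_3'$ with $(\sigma_1,\sigma_4)\in A,(\sigma_4,\sigma_3')\in B,(\sigma_3,\sigma_3')\in R$. Phase-annotated system: for each $i$ sets $\mathcal R_i,\mathcal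 L_i,\mathcal N_i$ and a thread bisimulation $\cong_i$ with, for all $i$, $j\ne i$: $S=\mathcal R_i\uplus\mathcal L_i\uplus\mathcal N_i$; $\to_i\cap\to_j=\emptyset$; $\to_i\subseteq\mathcal L_j^2\cup\mathcal R_j^2\cup\mathcal N_j^2$; $\cong_i\subseteq\mathcal L_j^2\cup\mathcal R_j^2\cup\mathcal N_j^2$. For $X\subseteq T$, $\cong_X=(\bigcup_{i\in X}\cong_i)^*$. Parallel transaction system: additionally for all $i$, $j\ne i$: $\mathcal L_i\lhd\to_i\rhd\mathcal R_i=\emptyset$; $\to_i\rhd\mathcal R_i$ right-commutes with $\to_j$ up to $\cong_{\{j\}}$; $\mathcal L_i\lhd\to_i$ left-commutes with $\to_j$ up to $\cong_{\{i,j\}}$; every $\sigma\in\mathcal L_i$ has some $\sigma'\in\mathcal N_i$ with $\sigma\to_i^{+}\sigma'$. A uts (uncommitted transaction sequence) under $T'$ is a path $q_1\to_{\psi(1)}^{+}q_2\cdots\to_{\psi(l)}^{+}q_{l+1}$ ($l\ge0$) whose blocks are $q_k=q_{k,1}\to_{\psi(k)}\cdots\to_{\psi(k)}q_{k,x_k}=q_{k+1}$ with $\psi(k)\in T'$, $q_1\in\mathcal N_{T'}$, $q_{k,1}\in\mathcal N_{\psi(k)}$ and $q_{k,2},\dots,q_{k,x_k}\in\mathcal R_{\psi(k)}$. -}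

module Defs where

open import Level using (0ℓ)
open import Data.Nat using (ℕ; suc)
open import Data.Fin using (Fin; zero; suc; inject₁)
open import Data.Product using (_×_; ∃; Σ)
open import Data.Sum using (_⊎_)
open import Data.Empty using (⊥)
open import Relation.Nullary using (¬_)
open import Relation.Unary using (Pred)
open import Relation.Binary using (Rel; IsEquivalence)
open import Relation.Binary.PropositionalEquality using (_≡_; _≢_)
open import Relation.Binary.Construct.Closure.ReflexiveTransitive using (Star)
open import Relation.Binary.Construct.Closure.Transitive using (TransClosure)

_◁_ : {S : Set} → Pred S 0ℓ → Rel S 0ℓ → Rel S 0ℓ
(X ◁ Q) a b = X a × Q a b

_▷_ : {S : Set} → Rel S 0ℓ → Pred S 0ℓ → Rel S 0ℓ
(Q ▷ X) a b = Q a b × X b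

Preserves3 : {S : Set} → Rel S 0ℓ → Pred S 0ℓ → Pred S 0ℓ → Pred S 0ℓ → Set
Preserves3 Q L R N = ∀ {a b} → Q a b → (L a × L b) ⊎ (R a × R b) ⊎ (N a × N b)

IsThreadBisim : {n : ℕ} {S : Set} → (Fin n → Rel S 0ℓ) → Rel S 0ℓ → Set
IsThreadBisim step R =
  IsEquivalence R ×
  (∀ {σ σ' σ₁} i → R σ σ' → step i σ σ₁ → ∃ λ σ₁' → step i σ' σ₁' × R σ₁ σ₁')

RightComm : {S : Set} → Rel S 0ℓ → Rel S 0ℓ → Rel S 0ℓ → Set
RightComm A B R = ∀ {σ₁ σ₂ σ₃} → A σ₁ σ₂ → B σ₂ σ₃ →
  Σ _ λ σ₄ → Σ _ λ σ₃' → B σ₁ σ₄ × A σ₄ σ₃' × R σ₃ σ₃'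

LeftComm : {S : Set} → Rel S 0ℓ → Rel S 0ℓ → Rel S 0ℓ → Set
LeftComm A B R = ∀ {σ₁ σ₂ σ₃} → B σ₁ σ₂ → A σ₂ σ₃ →
  Σ _ λ σ₄ → Σ _ λ σ₃' → A σ₁ σ₄ × B σ₄ σ₃' × R σ₃ σ₃'

CongSet : {n : ℕ} {S : Set} → (Fin n → Rel S 0ℓ) → Pred (Fin n) 0ℓ → Rel S 0ℓ
CongSet cong X = Star (λ a b → ∃ λ k → X k × cong k a b)

record PhaseAnnotated (n : ℕ) (S : Set) (step : Fin n → Rel S 0ℓ) : Set₁ where
  field
    R L N : Fin n → Pred S 0ℓ
    cong : Fin n → Rel S 0ℓ
    cong-bisim : ∀ i → IsThreadBisim step (cong i)
    cover : ∀ i σ → R i σ ⊎ L i σ ⊎ N i σ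
    RL-disj : ∀ i σ → ¬ (R i σ × L i σ)
    RN-disj : ∀ i σ → ¬ (R i σ × N i σ)
    LN-disj : ∀ i σ → ¬ (L i σ × N i σ)
    step-disj : ∀ i j → i ≢ j → ∀ σ σ' → ¬ (step i σ σ' × step j σ σ')
    step-pres : ∀ i j → j ≢ i → Preserves3 (step i) (L j) (R j) (N j)
    cong-pres : ∀ i j → j ≢ i → Preserves3 (cong i) (L j) (R j) (N j)

record ParallelTS (n : ℕ) (S : Set) (step : Fin n → Rel S 0ℓ) : Set₁ where
  field
    pas : PhaseAnnotated n S step
  open PhaseAnnotated pas public
  field
    noLR : ∀ i σ σ' → ¬ (((L i ◁ step i) ▷ R i) σ σ')
    rightComm : ∀ i j → j ≢ i →
      RightComm (step i ▷ R i) (step j) (CongSet cong (λ k → k ≡ j))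
    leftComm : ∀ i j → j ≢ i →
      LeftComm (L i ◁ step i) (step j) (CongSet cong (λ k → k ≡ i ⊎ k ≡ j))
    L-exit : ∀ i σ → L i σ → ∃ λ σ' → N i σ' × TransClosure (step i) σ σ'

module _ {n : ℕ} {S : Set} {step : Fin n → Rel S 0ℓ} (P : ParallelTS n S step) where
  open ParallelTS P

  NSet : Pred (Fin n) 0ℓ → Pred S 0ℓ
  NSet X σ = ∀ i → X i → N i σ

  data RTail (i : Fin n) : Rel S 0ℓ where
    last : ∀ {a b} → step i a b → R i b → RTail i a b
    more : ∀ {a c b} → step i a c → R i c → RTail i c b → RTail i a b

  Block : Fin n → Rel S 0ℓ
  Block i a b = N i a × RTail i a b

  record UTS (T' : Pred (Fin n) 0ℓ) : Set where
    field
      l : ℕ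
      ψ : Fin l → Fin n
      q : Fin (suc l) → S
      ψ∈T' : ∀ k → T' (ψ k)
      q₁∈N : NSet T' (q zero)
      blocks : ∀ k → Block (ψ k) (q (inject₁ k)) (q (suc k))

module Submission where

open import Defs
open import Level using (0ℓ)
open import Data.Nat using (ℕ) renaming (_≤_ to _≤ℕ_)
open import Data.Fin using (Fin; zero; suc; inject₁; toℕ; _≤_; _<_; _≟_)
open import Data.Fin.Properties using (toℕ-inject₁; <-cmp)
open import Data.Fin.Induction using (<-weakInduction-startingFrom)
open import Data.Product using (_,_; proj₁; proj₂)
open import Data.Sum using (inj₁; inj₂)
open import Data.Empty using (⊥-elim)
open import Relation.Nullary using (yes; no)
open import Relation.Unary using (Pred)
open import Relation.Binary using (Rel; tri<; tri≈; tri>)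
open import Relation.Binary.PropositionalEquality using (_≢_; sym; subst)

-- Once a uts has run a block of thread t it sits in R_t, and R_t is never left:
-- a block of another thread preserves it, while a new block of t would have to
-- start in N_t.  Hence no thread owns two blocks.

module _ {n : ℕ} {S : Set} {step : Fin n → Rel S 0ℓ} where

  module _ (pas : PhaseAnnotated n S step) where
    open PhaseAnnotated pas

    step-preserves-R : ∀ {i t a b} → t ≢ i → step i a b → R t a → R t b
    step-preserves-R {i} {t} t≢i a→b Ra with step-pres i t t≢i a→b
    ... | inj₁ (La , _)        = ⊥-elim (RL-disj t _ (Ra , La))
    ... | inj₂ (inj₁ (_ , Rb)) = Rb
    ... | inj₂ (inj₂ (Na , _)) = ⊥-elim (RN-disj t _ (Ra , Na))

  module _ (P : ParallelTS n S step) where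
    open ParallelTS P

    RTail-ends-in-R : ∀ {i a b} → RTail P i a b → R i b
    RTail-ends-in-R (last _ Rb)     = Rb
    RTail-ends-in-R (more _ _ tail) = RTail-ends-in-R tail

    RTail-preserves-R : ∀ {i t a b} → t ≢ i → RTail P i a b → R t a → R t b
    RTail-preserves-R t≢i (last a→b _) Ra = step-preserves-R pas t≢i a→b Ra
    RTail-preserves-R t≢i (more a→c _ tail) Ra =
      RTail-preserves-R t≢i tail (step-preserves-R pas t≢i a→c Ra)

    Block-preserves-R : ∀ {i t a b} → Block P i a b → R t a → R t b
    Block-preserves-R {i} {t} (Na , tail) Ra with t ≟ i
    ... | yes t≡i = ⊥-elim (RN-disj t _ (Ra , subst (λ k → N k _) (sym t≡i) Na))
    ... | no  t≢i = RTail-preserves-R t≢i tail Ra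

    module _ {T' : Pred (Fin n) 0ℓ} (u : UTS P T') where
      open UTS u

      UTS-R-persists : ∀ t {k k′} → k ≤ k′ → R t (q k) → R t (q k′)
      UTS-R-persists t k≤k′ Rk =
        <-weakInduction-startingFrom (λ k → R t (q k)) Rk
          (λ k → Block-preserves-R (blocks k)) k≤k′

      UTS-ψ-<-distinct : ∀ {i j} → i < j → ψ i ≢ ψ j
      UTS-ψ-<-distinct {i} {j} i<j ψi≡ψj =
        RN-disj (ψ j) (q (inject₁ j)) (R-at-start-of-j , proj₁ (blocks j))
        where
        suc-i≤inject₁-j : suc i ≤ inject₁ j
        suc-i≤inject₁-j = subst (toℕ (suc i) ≤ℕ_) (sym (toℕ-inject₁ j)) i<j

        R-at-start-of-j : R (ψ j) (q (inject₁ j))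
        R-at-start-of-j = subst (λ t → R t (q (inject₁ j))) ψi≡ψj
          (UTS-R-persists (ψ i) suc-i≤inject₁-j (RTail-ends-in-R (proj₂ (blocks i))))

corollary5 : {n : ℕ} {S : Set} {step : Fin n → Rel S 0ℓ} (P : ParallelTS n S step)
    (T' : Pred (Fin n) 0ℓ) (u : UTS P T') (i j : Fin (UTS.l u)) →
    i ≢ j → UTS.ψ u i ≢ UTS.ψ u j
corollary5 P T' u i j i≢j with <-cmp i j
... | tri< i<j _ _ = UTS-ψ-<-distinct P u i<j
... | tri≈ _ i≡j _ = ⊥-elim (i≢j i≡j)
... | tri> _ _ j<i = λ ψi≡ψj → UTS-ψ-<-distinct P u j<i (sym ψi≡ψj)
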